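{- Let $T$ be a non-trivial min-cut tree of a simple graph $G$. Then every leaf block $A$ of $T$ (block of degree $1$ in $T$) satisfies $|A|\geq\delta(G)$.
   Context: For $X\subseteq V$, $d_G(X)$ is the number of edges with exactly one endpoint in $X$. A cut is a set $\emptyset\neq X\subsetneq V$; trivial if $|X|=1$ or $|V\setminus X|=1$. $\lambda(G)=\min_X d_G(X)$; a min-cut is a cut with $d_G(X)=\lambda(G)$; $X$ separates $a,b$ if exactly one lies in $X$. For a tree $T$ whose vertex set (blocks) is a partition of $V$ and an edge $AB$, $C_{AB}$ is the union of blocks in the component of $T-AB$ containing $A$. A non-trivial min-cut tree is such a tree with: (i) for every edge $AB$, $C_{AB}$ is a non-trivial min-cut of $G$; (ii) every two vertices separated by some non-trivial min-cut of $G$ are separated by $C_{AB}$ for some edge $AB$ of $T$. -}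

module Defs where

open import Data.Nat using (ℕ; zero; suc; _≤_; _⊓_; _∸_)
open import Data.Fin using (Fin; zero; suc)
open import Data.Fin.Properties using (_≟_)
open import Data.Bool using (Bool; true; false; if_then_else_; _∧_; not)
open import Data.List using (List; []; _∷_; _++_; [_]; length; map; foldr; filter; allFin)
open import Data.Nat.ListAction using (sum)
open import Data.List.Relation.Unary.Linked using (Linked)
open import Data.List.Relation.Unary.Unique.Propositional using (Unique)
open import Data.Product using (Σ; _×_; ∃; _,_)
open import Data.Sum using (_⊎_)
open import Relation.Binary.PropositionalEquality using (_≡_; _≢_)
open import Relation.Nullary using (¬_)
open import Function.Bundles using (_⇔_)

record SimpleGraph (n : ℕ) : Set where
  field
    adj   : Fin n → Fin n → Bool
    sym   : ∀ u v → adj u v ≡ adj v u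
    irref : ∀ u → adj u u ≡ false
open SimpleGraph public

Subset : ℕ → Set
Subset n = Fin n → Bool

size : ∀ {n} → Subset n → ℕ
size {n} X = length (filter (λ v → X v Data.Bool.≟ true) (allFin n))

-- d_G(X): number of edges with exactly one endpoint in X
-- (each such edge uv is counted once, as the ordered pair with u ∈ X, v ∉ X)
d : ∀ {n} → SimpleGraph n → Subset n → ℕ
d {n} G X = sum (map (λ u → sum (map (λ v →
      if adj G u v ∧ X u ∧ not (X v) then 1 else 0) (allFin n))) (allFin n))

-- degree of a vertex and minimum degree δ(G) (δ = 0 for the empty graph)
deg : ∀ {n} → SimpleGraph n → Fin n → ℕ
deg {n} G u = size (adj G u)

δ : ∀ {n} → SimpleGraph n → ℕ
δ {zero}  G = 0
δ {suc m} G = foldr (λ v acc → deg G v ⊓ acc) (deg G zero) (allFin (suc m))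

IsCut : ∀ {n} → Subset n → Set
IsCut X = (∃ λ v → X v ≡ true) × (∃ λ v → X v ≡ false)

IsMinCut : ∀ {n} → SimpleGraph n → Subset n → Set
IsMinCut {n} G X = IsCut X × (∀ (Y : Subset n) → IsCut Y → d G X ≤ d G Y)

NonTrivial : ∀ {n} → Subset n → Set
NonTrivial {n} X = (size X ≢ 1) × (n ∸ size X ≢ 1)

IsNTMinCut : ∀ {n} → SimpleGraph n → Subset n → Set
IsNTMinCut G X = IsMinCut G X × NonTrivial X

data Reach {k : ℕ} (R : Fin k → Fin k → Set) : Fin k → Fin k → Set where
  here : ∀ {x} → Reach R x x
  step : ∀ {x y z} → R x y → Reach R y z → Reach R x z

Adj : ∀ {k} → SimpleGraph k → Fin k → Fin k → Set
Adj T u v = adj T u v ≡ true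

IsCycle : ∀ {k} → SimpleGraph k → List (Fin k) → Set
IsCycle T []       = Data.Empty.⊥ where import Data.Empty
IsCycle T (x ∷ xs) = (3 ≤ length (x ∷ xs)) × Unique (x ∷ xs) × Linked (Adj T) (x ∷ xs ++ [ x ])

IsTree : ∀ {k} → SimpleGraph k → Set
IsTree {k} T = (∀ (A B : Fin k) → Reach (Adj T) A B) × (∀ (c : List (Fin k)) → ¬ IsCycle T c)

AdjMinus : ∀ {k} → SimpleGraph k → Fin k → Fin k → Fin k → Fin k → Set
AdjMinus T A B u v = Adj T u v × ¬ ((u ≡ A × v ≡ B) ⊎ (u ≡ B × v ≡ A))

blockSize : ∀ {n k} → (Fin n → Fin k) → Fin k → ℕ
blockSize {n} f A = length (filter (λ v → f v ≟ A) (allFin n))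

-- A non-trivial min-cut tree of G: k blocks, block map f : V → Fin k
-- (blocks are the nonempty fibres of f, so they partition V), and a tree T on the blocks.
record NTMinCutTree {n : ℕ} (G : SimpleGraph n) : Set where
  field
    k      : ℕ
    block  : Fin n → Fin k
    nonempty : ∀ (A : Fin k) → ∃ λ v → block v ≡ A
    T      : SimpleGraph k
    tree   : IsTree T
  -- v ∈ C_AB  iff  the block of v lies in the component of T − AB containing A
  InC : Fin k → Fin k → Fin n → Set
  InC A B v = Reach (AdjMinus T A B) A (block v)
  field
    cond-i  : ∀ (A B : Fin k) → Adj T A B →
              Σ (Subset n) λ X → (∀ v → (X v ≡ true) ⇔ InC A B v) × IsNTMinCut G X
    cond-ii : ∀ (a b : Fin n) →
              (Σ (Subset n) λ Y → IsNTMinCut G Y × Y a ≢ Y b) →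
              Σ (Fin k) λ A → Σ (Fin k) λ B → Adj T A B ×
                ((InC A B a × ¬ InC A B b) ⊎ (¬ InC A B a × InC A B b))
open NTMinCutTree public

module Submission where

-- Let A be a leaf of T with unique neighbour B.  Every walk in T − AB that
-- starts at A stays at A, so the cut C_AB is exactly the block A; by (i) it is
-- a non-trivial min-cut X, and the theorem follows from a general fact about
-- simple graphs:
--
--   every min-cut X with |X| ≠ 1 satisfies |X| ≥ δ(G).
--
-- Proof of the fact: d(X) ≤ δ, because the edges at a vertex of minimum
-- degree form a (trivial) cut.  Counting degrees inside X,
--   |X|·δ ≤ Σ_{u∈X} deg u = d(X) + Σ_{u∈X} |N(u) ∩ X| ≤ δ + |X|(|X| − 1),
-- and since |X| ≥ 2 this rearranges to δ ≤ |X|.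

open import Defs
open import Data.Nat using (ℕ; _≤_)
open import Data.Fin using (Fin)
open import Relation.Binary.PropositionalEquality using (_≡_)

open import Data.Nat using (zero; suc; _+_; _*_; _∸_; _⊓_; z≤n)
open import Data.Nat.Properties
  using ( ≤-refl; ≤-reflexive; ≤-trans; module ≤-Reasoning
        ; +-identityʳ; *-identityˡ; *-comm; *-distribʳ-+; +-commutativeSemigroup
        ; +-mono-≤; +-monoˡ-≤; +-monoʳ-≤; *-monoʳ-≤; +-cancelˡ-≤; *-cancelˡ-≤
        ; m≤m+n; m+n≤o⇒m≤o∸n; m⊓n≤m; m⊓n≤n; ⊓-sel )
open import Data.Nat.ListAction using (sum)
open import Data.Fin using (zero; suc)
open import Data.Fin.Properties using (_≟_)
open import Data.Bool using (Bool; true; false; _∧_; not; if_then_else_)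
import Data.Bool as Bool
open import Data.List using (List; []; _∷_; map; foldr; filter; allFin; tabulate; length)
open import Data.List.Properties using (filter-some; filter-≐)
open import Data.List.Membership.Propositional using (_∈_; lose)
open import Data.List.Membership.Propositional.Properties
  using (∈-allFin; ∈-filter⁺; ∈-filter⁻)
open import Data.List.Relation.Unary.Any using (here; there)
open import Data.Product using (Σ; _×_; ∃; _,_; proj₂)
open import Data.Sum using (inj₁; inj₂)
open import Data.Empty using (⊥-elim)
open import Relation.Nullary using (Dec; yes; no; does)
open import Relation.Nullary.Decidable using (dec-true; dec-false)
open import Relation.Binary.PropositionalEquality
  using (_≢_; refl; trans; cong; cong₂; subst; module ≡-Reasoning)
import Relation.Binary.PropositionalEquality as ≡
open import Function.Bundles using (Equivalence; _⇔_)
open import Algebra.Properties.CommutativeSemigroup +-commutativeSemigroup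
  using (interchange)

χ : Bool → ℕ
χ b = if b then 1 else 0

∑ : {A : Set} → List A → (A → ℕ) → ℕ
∑ l f = sum (map f l)

∑-cong : {A : Set} (l : List A) {f g : A → ℕ} → (∀ x → f x ≡ g x) → ∑ l f ≡ ∑ l g
∑-cong []      f≡g = refl
∑-cong (x ∷ l) f≡g = cong₂ _+_ (f≡g x) (∑-cong l f≡g)

∑-mono : {A : Set} (l : List A) {f g : A → ℕ} → (∀ x → f x ≤ g x) → ∑ l f ≤ ∑ l g
∑-mono []      f≤g = z≤n
∑-mono (x ∷ l) f≤g = +-mono-≤ (f≤g x) (∑-mono l f≤g)

∑-zero : {A : Set} (l : List A) {f : A → ℕ} → (∀ x → f x ≡ 0) → ∑ l f ≡ 0
∑-zero []      f≡0 = refl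
∑-zero (x ∷ l) f≡0 = cong₂ _+_ (f≡0 x) (∑-zero l f≡0)

∑-+ : {A : Set} (l : List A) (f g : A → ℕ) → ∑ l (λ x → f x + g x) ≡ ∑ l f + ∑ l g
∑-+ []      f g = refl
∑-+ (x ∷ l) f g = trans (cong (f x + g x +_) (∑-+ l f g)) (interchange (f x) (g x) (∑ l f) (∑ l g))

∑-*ʳ : {A : Set} (l : List A) (f : A → ℕ) (c : ℕ) → ∑ l (λ x → f x * c) ≡ ∑ l f * c
∑-*ʳ []      f c = refl
∑-*ʳ (x ∷ l) f c = trans (cong (f x * c +_) (∑-*ʳ l f c)) (≡.sym (*-distribʳ-+ c (f x) (∑ l f)))

∑-tabulate : ∀ {m n} (h : Fin m → Fin n) (f : Fin n → ℕ) →
             ∑ (tabulate h) f ≡ ∑ (allFin m) (λ x → f (h x))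
∑-tabulate {zero}  h f = refl
∑-tabulate {suc m} h f = cong (f (h zero) +_) (begin
    ∑ (tabulate (λ x → h (suc x))) f
  ≡⟨ ∑-tabulate (λ x → h (suc x)) f ⟩
    ∑ (allFin m) (λ x → f (h (suc x)))
  ≡⟨ ≡.sym (∑-tabulate suc (λ x → f (h x))) ⟩
    ∑ (tabulate suc) (λ x → f (h x)) ∎)
  where open ≡-Reasoning

∑-select : ∀ {n} (w : Fin n) (f : Fin n → ℕ) →
           ∑ (allFin n) (λ u → χ (does (u ≟ w)) * f u) ≡ f w
∑-select {suc n} zero f = begin
    1 * f zero + ∑ (tabulate suc) (λ u → χ (does (u ≟ zero)) * f u)
  ≡⟨ cong₂ _+_ (*-identityˡ (f zero)) offW ⟩
    f zero + 0
  ≡⟨ +-identityʳ (f zero) ⟩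
    f zero ∎
  where
  open ≡-Reasoning
  offW : ∑ (tabulate suc) (λ u → χ (does (u ≟ zero)) * f u) ≡ 0
  offW = trans (∑-tabulate {n} {suc n} suc _) (∑-zero (allFin n) (λ _ → refl))
∑-select {suc n} (suc w) f = begin
    0 + ∑ (tabulate suc) (λ u → χ (does (u ≟ suc w)) * f u)
  ≡⟨ ∑-tabulate {n} {suc n} suc _ ⟩
    ∑ (allFin n) (λ u → χ (does (suc u ≟ suc w)) * f (suc u))
  ≡⟨ ∑-cong (allFin n) shift ⟩
    ∑ (allFin n) (λ u → χ (does (u ≟ w)) * f (suc u))
  ≡⟨ ∑-select w (λ u → f (suc u)) ⟩
    f (suc w) ∎
  where
  open ≡-Reasoning
  shift : ∀ u → χ (does (suc u ≟ suc w)) * f (suc u) ≡ χ (does (u ≟ w)) * f (suc u)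
  shift u with u ≟ w
  ... | yes _ = refl
  ... | no  _ = refl

module _ {n : ℕ} where

  _∈?_ : (v : Fin n) (X : Subset n) → Dec (X v ≡ true)
  v ∈? X = X v Bool.≟ true

  size-as-∑ : (X : Subset n) → size X ≡ ∑ (allFin n) (λ v → χ (X v))
  size-as-∑ X = count (allFin n)
    where
    count : (l : List (Fin n)) → length (filter (_∈? X) l) ≡ ∑ l (λ v → χ (X v))
    count []      = refl
    count (v ∷ l) with X v
    ... | true  = cong suc (count l)
    ... | false = count l

  size-pos : (X : Subset n) (v : Fin n) → X v ≡ true → 1 ≤ size X
  size-pos X v Xv = filter-some (_∈? X) (lose (∈-allFin v) Xv)

  size-one⇒singleton : (X : Subset n) → size X ≡ 1 →
                       Σ (Fin n) λ w → X w ≡ true × (∀ v → X v ≡ true → v ≡ w)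
  size-one⇒singleton X |X|≡1 with filter (_∈? X) (allFin n) in members | |X|≡1
  ... | w ∷ [] | _ = w , proj₂ (∈-filter⁻ (_∈? X) {xs = allFin n} w∈X) , onlyW
    where
    w∈X : w ∈ filter (_∈? X) (allFin n)
    w∈X = subst (w ∈_) (≡.sym members) (here refl)
    onlyW : ∀ v → X v ≡ true → v ≡ w
    onlyW v Xv with subst (v ∈_) members (∈-filter⁺ (_∈? X) (∈-allFin v) Xv)
    ... | here v≡w = v≡w

  ∑∈ : Subset n → (Fin n → ℕ) → ℕ
  ∑∈ X f = ∑ (allFin n) (λ u → χ (X u) * f u)

  ∑∈-const : (X : Subset n) (c : ℕ) → ∑∈ X (λ _ → c) ≡ size X * c
  ∑∈-const X c = trans (∑-*ʳ (allFin n) (λ u → χ (X u)) c) (cong (_* c) (≡.sym (size-as-∑ X)))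

  ∑∈-mono : (X : Subset n) {f g : Fin n → ℕ} → (∀ u → X u ≡ true → f u ≤ g u) →
            ∑∈ X f ≤ ∑∈ X g
  ∑∈-mono X {f} {g} f≤g = ∑-mono (allFin n) termwise
    where
    termwise : ∀ u → χ (X u) * f u ≤ χ (X u) * g u
    termwise u with X u in Xu
    ... | true  = *-monoʳ-≤ 1 (f≤g u Xu)
    ... | false = z≤n

  singleton : Fin n → Subset n
  singleton w u = does (u ≟ w)

module _ {n : ℕ} (G : SimpleGraph n) where

  minDeg : Fin n → ℕ → ℕ
  minDeg v acc = deg G v ⊓ acc

  fold-≤ : ∀ b (l : List (Fin n)) u → u ∈ l → foldr minDeg b l ≤ deg G u
  fold-≤ b (x ∷ l) .x (here refl) = m⊓n≤m (deg G x) _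
  fold-≤ b (x ∷ l) u  (there u∈l) = ≤-trans (m⊓n≤n (deg G x) _) (fold-≤ b l u u∈l)

  fold-attained : ∀ w (l : List (Fin n)) → ∃ λ v → deg G v ≡ foldr minDeg (deg G w) l
  fold-attained w []      = w , refl
  fold-attained w (x ∷ l) with fold-attained w l | ⊓-sel (deg G x) (foldr minDeg (deg G w) l)
  ... | _ , _  | inj₁ takesX    = x , ≡.sym takesX
  ... | v , v≡ | inj₂ takesRest = v , trans v≡ (≡.sym takesRest)

δ-≤-deg : ∀ {n} (G : SimpleGraph n) u → δ G ≤ deg G u
δ-≤-deg {suc m} G u = fold-≤ G (deg G zero) (allFin (suc m)) u (∈-allFin u)

δ-attained : ∀ {m} (G : SimpleGraph (suc m)) → ∃ λ w → deg G w ≡ δ G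
δ-attained {m} G = fold-attained G zero (allFin (suc m))

module _ {n : ℕ} (G : SimpleGraph n) where

  outDeg innerDeg : Subset n → Fin n → ℕ
  outDeg   X u = ∑ (allFin n) (λ v → χ (adj G u v ∧ not (X v)))
  innerDeg X u = ∑ (allFin n) (λ v → χ (adj G u v ∧ X v))

  deg-split : (X : Subset n) (u : Fin n) → deg G u ≡ outDeg X u + innerDeg X u
  deg-split X u = begin
      deg G u
    ≡⟨ size-as-∑ (adj G u) ⟩
      ∑ (allFin n) (λ v → χ (adj G u v))
    ≡⟨ ∑-cong (allFin n) (λ v → split (adj G u v) (X v)) ⟩
      ∑ (allFin n) (λ v → χ (adj G u v ∧ not (X v)) + χ (adj G u v ∧ X v))
    ≡⟨ ∑-+ (allFin n) _ _ ⟩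
      outDeg X u + innerDeg X u ∎
    where
    open ≡-Reasoning
    split : ∀ a b → χ a ≡ χ (a ∧ not b) + χ (a ∧ b)
    split true  true  = refl
    split true  false = refl
    split false _     = refl

  -- Σ_{u∈X} deg u = d(X) + Σ_{u∈X} |N(u) ∩ X|: the u-th row of d(X) is
  -- outDeg X u for u ∈ X and empty otherwise.
  degree-sum : (X : Subset n) → ∑∈ X (deg G) ≡ d G X + ∑∈ X (innerDeg X)
  degree-sum X = trans (∑-cong (allFin n) row) (∑-+ (allFin n) cutRow _)
    where
    cutRow : Fin n → ℕ
    cutRow u = ∑ (allFin n) (λ v → χ (adj G u v ∧ X u ∧ not (X v)))
    row : ∀ u → χ (X u) * deg G u ≡ cutRow u + χ (X u) * innerDeg X u
    row u with X u
    ... | true  = begin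
        1 * deg G u                          ≡⟨ *-identityˡ (deg G u) ⟩
        deg G u                              ≡⟨ deg-split X u ⟩
        outDeg X u + innerDeg X u            ≡⟨ cong (outDeg X u +_) (≡.sym (*-identityˡ _)) ⟩
        outDeg X u + 1 * innerDeg X u        ∎
      where open ≡-Reasoning
    ... | false = ≡.sym (trans (+-identityʳ _) (∑-zero (allFin n) (λ v → absorb (adj G u v))))
      where
      absorb : ∀ a → χ (a ∧ false) ≡ 0
      absorb true  = refl
      absorb false = refl

  -- A vertex of X has at most |X| − 1 neighbours in X (no loops).
  innerDeg-≤ : (X : Subset n) (u : Fin n) → X u ≡ true → innerDeg X u ≤ size X ∸ 1
  innerDeg-≤ X u Xu = m+n≤o⇒m≤o∸n (innerDeg X u) (begin
      innerDeg X u + 1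
    ≡⟨ cong (innerDeg X u +_) (≡.sym (∑-select u (λ _ → 1))) ⟩
      innerDeg X u + ∑ (allFin n) (λ v → χ (does (v ≟ u)) * 1)
    ≡⟨ ≡.sym (∑-+ (allFin n) _ _) ⟩
      ∑ (allFin n) (λ v → χ (adj G u v ∧ X v) + χ (does (v ≟ u)) * 1)
    ≤⟨ ∑-mono (allFin n) termwise ⟩
      ∑ (allFin n) (λ v → χ (X v))
    ≡⟨ ≡.sym (size-as-∑ X) ⟩
      size X ∎)
    where
    open ≤-Reasoning
    termwise : ∀ v → χ (adj G u v ∧ X v) + χ (does (v ≟ u)) * 1 ≤ χ (X v)
    termwise v with v ≟ u
    ... | yes refl rewrite irref G v | Xu = ≤-refl
    ... | no _ with adj G u v | X v
    ...   | true  | true  = ≤-refl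
    ...   | true  | false = ≤-refl
    ...   | false | true  = z≤n
    ...   | false | false = ≤-refl

  d-≤-degree-sum : (X : Subset n) → d G X ≤ ∑∈ X (deg G)
  d-≤-degree-sum X = ≤-trans (m≤m+n (d G X) _) (≤-reflexive (≡.sym (degree-sum X)))

  degree-count : (X : Subset n) → size X * δ G ≤ d G X + size X * (size X ∸ 1)
  degree-count X = begin
      size X * δ G
    ≡⟨ ≡.sym (∑∈-const X (δ G)) ⟩
      ∑∈ X (λ _ → δ G)
    ≤⟨ ∑∈-mono X (λ u _ → δ-≤-deg G u) ⟩
      ∑∈ X (deg G)
    ≡⟨ degree-sum X ⟩
      d G X + ∑∈ X (innerDeg X)
    ≤⟨ +-monoʳ-≤ (d G X) (∑∈-mono X (innerDeg-≤ X)) ⟩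
      d G X + ∑∈ X (λ _ → size X ∸ 1)
    ≡⟨ cong (d G X +_) (∑∈-const X (size X ∸ 1)) ⟩
      d G X + size X * (size X ∸ 1) ∎
    where open ≤-Reasoning

-- λ(G) ≤ δ(G): the edges at a vertex w of minimum degree form the cut {w}
-- (a proper subset, since a cut exists at all only when n ≥ 2).
minCut-≤-δ : ∀ {n} (G : SimpleGraph n) (X : Subset n) → IsMinCut G X → d G X ≤ δ G
minCut-≤-δ {zero}  G X (((() , _) , _) , _)
minCut-≤-δ {suc m} G X (((a , Xa) , (b , Xb)) , minimal) with δ-attained G
... | w , degw≡δ = begin
    d G X                     ≤⟨ minimal (singleton w) ((w , dec-true (w ≟ w) refl) , outside) ⟩
    d G (singleton w)         ≤⟨ d-≤-degree-sum G (singleton w) ⟩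
    ∑∈ (singleton w) (deg G)  ≡⟨ ∑-select w (deg G) ⟩
    deg G w                   ≡⟨ degw≡δ ⟩
    δ G                       ∎
  where
  open ≤-Reasoning
  outside : ∃ λ v → singleton w v ≡ false
  outside with a ≟ w | b ≟ w
  ... | no a≢w   | _        = a , dec-false (a ≟ w) a≢w
  ... | yes _    | no b≢w   = b , dec-false (b ≟ w) b≢w
  ... | yes refl | yes refl with () ← trans (≡.sym Xa) Xb

-- Arithmetic core of the side bound: with s ≥ 2, s·D ≤ c + s(s − 1) and
-- c ≤ D give (s − 1)·D ≤ (s − 1)·s, hence D ≤ s.
side-bound : ∀ s {D c} → 1 ≤ s → s ≢ 1 → s * D ≤ c + s * (s ∸ 1) → c ≤ D → D ≤ s
side-bound (suc zero)    _ s≢1 _ _ = ⊥-elim (s≢1 refl)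
side-bound (suc r@(suc _)) {D} {c} _ _ hyp c≤D =
  *-cancelˡ-≤ r (+-cancelˡ-≤ D (r * D) (r * suc r) (begin
    suc r * D         ≤⟨ hyp ⟩
    c + suc r * r     ≤⟨ +-monoˡ-≤ (suc r * r) c≤D ⟩
    D + suc r * r     ≡⟨ cong (D +_) (*-comm (suc r) r) ⟩
    D + r * suc r     ∎))
  where open ≤-Reasoning

minCut-side-≥-δ : ∀ {n} (G : SimpleGraph n) (X : Subset n) →
                  IsMinCut G X → size X ≢ 1 → δ G ≤ size X
minCut-side-≥-δ G X minX@(((a , Xa) , _) , _) |X|≢1 =
  side-bound (size X) (size-pos X a Xa) |X|≢1 (degree-count G X) (minCut-≤-δ G X minX)

isolated-after-removal : ∀ {k} (T : SimpleGraph k) {A B : Fin k} →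
                         (∀ C → Adj T A C → C ≡ B) →
                         ∀ {Y} → Reach (AdjMinus T A B) A Y → Y ≡ A
isolated-after-removal T onlyB here                    = refl
isolated-after-removal T onlyB (step (A~C , notAB) _) = ⊥-elim (notAB (inj₁ (refl , onlyB _ A~C)))

leaf-cut-size : ∀ {n} {G : SimpleGraph n} (M : NTMinCutTree G) {A B : Fin (k M)} →
                (∀ C → Adj (T M) A C → C ≡ B) →
                (X : Subset n) → (∀ v → (X v ≡ true) ⇔ InC M A B v) →
                blockSize (block M) A ≡ size X
leaf-cut-size {n} M {A} onlyB X X≐C =
  cong length (filter-≐ (λ v → block M v ≟ A) (_∈? X) (inBlock⇒inX , inX⇒inBlock) (allFin n))
  where
  inBlock⇒inX : ∀ {v} → block M v ≡ A → X v ≡ true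
  inBlock⇒inX {v} refl = Equivalence.from (X≐C v) here
  inX⇒inBlock : ∀ {v} → X v ≡ true → block M v ≡ A
  inX⇒inBlock {v} Xv = isolated-after-removal (T M) onlyB (Equivalence.to (X≐C v) Xv)

lemma4 : ∀ {n} (G : SimpleGraph n) (M : NTMinCutTree G) (A : Fin (k M)) →
           deg (T M) A ≡ 1 → δ G ≤ blockSize (block M) A
lemma4 G M A leaf with size-one⇒singleton (adj (T M) A) leaf
... | B , A~B , onlyB with cond-i M A B A~B
...   | X , X≐C , minX , |X|≢1 , _ =
  subst (δ G ≤_) (≡.sym (leaf-cut-size M onlyB X X≐C)) (minCut-side-≥-δ G X minX |X|≢1)
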